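{- The rule $(\bot_r)$: from $\mathcal{G}/\!/\Gamma\vdash\Delta,\bot/\!/\mathcal{H}$ infer $\mathcal{G}/\!/\Gamma\vdash\Delta/\!/\mathcal{H}$, is height-preserving admissible in $\mathsf{LNIF}$: whenever the premise has an $\mathsf{LNIF}$-derivation of height $h$, the conclusion has an $\mathsf{LNIF}$-derivation of height at most $h$.
   Context: The height of a derivation is the number of sequents on its longest branch from the end sequent to an initial sequent. Formulae are first-order over $\bot,\land,\lor,\supset,\forall,\exists$; in sequents bound variables $x,y,\dots$ are distinct from parameters $a,b,\dots$, which occupy all free positions; $A[a/x]$ replaces free occurrences of $x$ by $a$; $p(\vec a)$ is an atomic formula with parameters $\vec a$. A linear nested sequent is $\Gamma_1\vdash\Delta_1 /\!/ \cdots /\!/ \Gamma_n\vdash\Delta_n$ ($n\ge1$), each $\Gamma_i,\Delta_i$ a finite, possibly empty, multiset of formulae (a component). In rule schemas, $\mathcal{G},\mathcal{H},\mathcal{F}$ denote possibly empty sequences of components. $\mathsf{LNIF}$ has the rules (from premise(s) infer conclusion): Initial: $(id_1)$ $\mathcal{G}/\!/\Gamma,p(\vec a)\vdash p(\vec a),\Delta/\!/\mathcal{H}$; $(id_2)$ $\mathcal{G}/\!/\Gamma_1,p(\vec a)\vdash\Delta_1/\!/\mathcal{H}/\!/\Gamma_2\vdash p(\vec a),\Delta_2/\!/\mathcal{F}$; $(\bot_l)$ $\mathcal{G}/\!/\Gamma,\bot\vdash\Delta/\!/\mathcal{H}$. $(\land_l)$: from $\mathcal{G}/\!/\Gamma,A,B\vdash\Delta/\!/\mathcal{H}$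 infer $\mathcal{G}/\!/\Gamma,A\land B\vdash\Delta/\!/\mathcal{H}$. $(\lor_r)$: from $\mathcal{G}/\!/\Gamma\vdash\Delta,A,B/\!/\mathcal{H}$ infer $\mathcal{G}/\!/\Gamma\vdash\Delta,A\lor B/\!/\mathcal{H}$. $(\land_r)$: from $\mathcal{G}/\!/\Gamma\vdash\Delta,A/\!/\mathcal{H}$ and $\mathcal{G}/\!/\Gamma\vdash\Delta,B/\!/\mathcal{H}$ infer $\mathcal{G}/\!/\Gamma\vdash\Delta,A\land B/\!/\mathcal{H}$. $(\lor_l)$: from $\mathcal{G}/\!/\Gamma,A\vdash\Delta/\!/\mathcal{H}$ and $\mathcal{G}/\!/\Gamma,B\vdash\Delta/\!/\mathcal{H}$ infer $\mathcal{G}/\!/\Gamma,A\lor B\vdash\Delta/\!/\mathcal{H}$. $(\supset_{r1})$: from $\mathcal{G}/\!/\Gamma\vdash\Delta/\!/A\vdash B$ infer $\mathcal{G}/\!/\Gamma\vdash\Delta,A\supset B$. $(\supset_l)$: from $\mathcal{G}/\!/\Gamma,B\vdash\Delta/\!/\mathcal{H}$ and $\mathcal{G}/\!/\Gamma,A\supset B\vdash A,\Delta/\!/\mathcal{H}$ infer $\mathcal{G}/\!/\Gamma,A\supset B\vdash\Delta/\!/\mathcal{H}$. $(lift)$: from $\mathcal{G}/\!/\Gamma_1,A\vdash\Delta_1/\!/\Gamma_2,A\vdash\Delta_2/\!/\mathcal{H}$ infer $\mathcal{G}/\!/\Gamma_1,A\vdash\Delta_1/\!/\Gamma_2\vdash\Delta_2/\!/\mathcal{H}$.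 $(\forall_l)$: from $\mathcal{G}/\!/\Gamma,A[a/x],\forall xA\vdash\Delta/\!/\mathcal{H}$ infer $\mathcal{G}/\!/\Gamma,\forall xA\vdash\Delta/\!/\mathcal{H}$ ($a$ any parameter). $(\forall_{r1})$: from $\mathcal{G}/\!/\Gamma\vdash\Delta/\!/\ \vdash A[a/x]$ infer $\mathcal{G}/\!/\Gamma\vdash\Delta,\forall xA$. $(\exists_l)$: from $\mathcal{G}/\!/\Gamma,A[a/x]\vdash\Delta/\!/\mathcal{H}$ infer $\mathcal{G}/\!/\Gamma,\exists xA\vdash\Delta/\!/\mathcal{H}$. $(\exists_r)$: from $\mathcal{G}/\!/\Gamma\vdash A[a/x],\exists xA,\Delta/\!/\mathcal{H}$ infer $\mathcal{G}/\!/\Gamma\vdash\exists xA,\Delta/\!/\mathcal{H}$ ($a$ any parameter). $(\supset_{r2})$: from $\mathcal{G}/\!/\Gamma_1\vdash\Delta_1/\!/A\vdash B/\!/\Gamma_2\vdash\Delta_2/\!/\mathcal{H}$ and $\mathcal{G}/\!/\Gamma_1\vdash\Delta_1/\!/\Gamma_2\vdash\Delta_2,A\supset B/\!/\mathcal{H}$ infer $\mathcal{G}/\!/\Gamma_1\vdash\Delta_1,A\supset B/\!/\Gamma_2\vdash\Delta_2/\!/\mathcal{H}$. $(\forall_{r2})$: from $\mathcal{G}/\!/\Gamma_1\vdash\Delta_1/\!/\ \vdash A[a/x]/\!/\Gamma_2\vdash\Delta_2/\!/\mathcal{H}$ and $\mathcal{G}/\!/\Gamma_1\vdash\Delta_1/\!/\Gamma_2\vdash\Delta_2,\forall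 xA/\!/\mathcal{H}$ infer $\mathcal{G}/\!/\Gamma_1\vdash\Delta_1,\forall xA/\!/\Gamma_2\vdash\Delta_2/\!/\mathcal{H}$. In $(\forall_{r1}),(\exists_l),(\forall_{r2})$, $a$ is an eigenvariable (does not occur in the conclusion). -}

module Defs where

open import Data.Nat using (ℕ; suc; _⊔_; _≡ᵇ_)
open import Data.Bool using (Bool; true; false; if_then_else_; _∨_; _∧_)
open import Data.List using (List; []; _∷_; _++_)
open import Data.Bool.ListAction using (any)
open import Data.List.Membership.Propositional using (_∈_)
open import Data.List.Relation.Unary.All using (All)
open import Data.List.Relation.Binary.Permutation.Propositional using (_↭_)
open import Relation.Binary.PropositionalEquality using (_≡_)
open import Data.Product using (_×_)

-- Terms: bound variables (names x,y,...) and parameters (a,b,...), both named by ℕ.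
data Term : Set where
  var : ℕ → Term
  par : ℕ → Term

data Fm : Set where
  atom : ℕ → List Term → Fm
  ⊥'   : Fm
  _∧'_ _∨'_ _⊃'_ : Fm → Fm → Fm
  ∀' ∃' : ℕ → Fm → Fm

substT : ℕ → ℕ → Term → Term
substT x a (var y) = if x ≡ᵇ y then par a else var y
substT x a (par b) = par b

substTs : ℕ → ℕ → List Term → List Term
substTs x a [] = []
substTs x a (t ∷ ts) = substT x a t ∷ substTs x a ts

_[_/_] : Fm → ℕ → ℕ → Fm
atom p ts [ a / x ] = atom p (substTs x a ts)
⊥' [ a / x ] = ⊥'
(A ∧' B) [ a / x ] = (A [ a / x ]) ∧' (B [ a / x ])
(A ∨' B) [ a / x ] = (A [ a / x ]) ∨' (B [ a / x ])
(A ⊃' B) [ a / x ] = (A [ a / x ]) ⊃' (B [ a / x ])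
∀' y A [ a / x ] = if x ≡ᵇ y then ∀' y A else ∀' y (A [ a / x ])
∃' y A [ a / x ] = if x ≡ᵇ y then ∃' y A else ∃' y (A [ a / x ])

occT : ℕ → Term → Bool
occT a (var _) = false
occT a (par b) = a ≡ᵇ b

occTs : ℕ → List Term → Bool
occTs a [] = false
occTs a (t ∷ ts) = occT a t ∨ occTs a ts

occ : ℕ → Fm → Bool
occ a (atom p ts) = occTs a ts
occ a ⊥' = false
occ a (A ∧' B) = occ a A ∨ occ a B
occ a (A ∨' B) = occ a A ∨ occ a B
occ a (A ⊃' B) = occ a A ∨ occ a B
occ a (∀' x A) = occ a A
occ a (∃' x A) = occ a A

closedT : List ℕ → Term → Bool
closedT bs (var x) = any (x ≡ᵇ_) bs
closedT bs (par _) = true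

closedTs : List ℕ → List Term → Bool
closedTs bs [] = true
closedTs bs (t ∷ ts) = closedT bs t ∧ closedTs bs ts

closedF : List ℕ → Fm → Bool
closedF bs (atom p ts) = closedTs bs ts
closedF bs ⊥' = true
closedF bs (A ∧' B) = closedF bs A ∧ closedF bs B
closedF bs (A ∨' B) = closedF bs A ∧ closedF bs B
closedF bs (A ⊃' B) = closedF bs A ∧ closedF bs B
closedF bs (∀' x A) = closedF (x ∷ bs) A
closedF bs (∃' x A) = closedF (x ∷ bs) A

-- A component Γ ⊢ Δ : two finite multisets, represented as lists
-- (the rules below work up to permutation, i.e. multiset equality).
infix 4 _▷_
record Comp : Set where
  constructor _▷_
  field
    ant : List Fm
    succ : List Fm
open Comp public

-- A linear nested sequent: a list of components (rules only ever derive nonempty ones).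
LNS : Set
LNS = List Comp

AllFms : (Fm → Set) → LNS → Set
AllFms P S = All (λ c → All P (ant c) × All P (succ c)) S

Fresh : ℕ → LNS → Set
Fresh a = AllFms (λ A → occ a A ≡ false)

ClosedS : LNS → Set
ClosedS = AllFms (λ A → closedF [] A ≡ true)

-- Derivations in LNIF.  Γ' ↭ X ∷ Γ expresses the multiset Γ' = Γ, X.
data Deriv : LNS → Set where
  id₁ : ∀ G H Γ Δ p ts → atom p ts ∈ Γ → atom p ts ∈ Δ →
        Deriv (G ++ (Γ ▷ Δ) ∷ H)
  id₂ : ∀ G H F Γ₁ Δ₁ Γ₂ Δ₂ p ts → atom p ts ∈ Γ₁ → atom p ts ∈ Δ₂ →
        Deriv (G ++ (Γ₁ ▷ Δ₁) ∷ H ++ (Γ₂ ▷ Δ₂) ∷ F)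
  ⊥l  : ∀ G H Γ Δ → ⊥' ∈ Γ → Deriv (G ++ (Γ ▷ Δ) ∷ H)
  ∧l  : ∀ G H Γ Γ' Δ A B → Γ' ↭ (A ∧' B) ∷ Γ →
        Deriv (G ++ (A ∷ B ∷ Γ ▷ Δ) ∷ H) →
        Deriv (G ++ (Γ' ▷ Δ) ∷ H)
  ∨r  : ∀ G H Γ Δ Δ' A B → Δ' ↭ (A ∨' B) ∷ Δ →
        Deriv (G ++ (Γ ▷ A ∷ B ∷ Δ) ∷ H) →
        Deriv (G ++ (Γ ▷ Δ') ∷ H)
  ∧r  : ∀ G H Γ Δ Δ' A B → Δ' ↭ (A ∧' B) ∷ Δ →
        Deriv (G ++ (Γ ▷ A ∷ Δ) ∷ H) →
        Deriv (G ++ (Γ ▷ B ∷ Δ) ∷ H) →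
        Deriv (G ++ (Γ ▷ Δ') ∷ H)
  ∨l  : ∀ G H Γ Γ' Δ A B → Γ' ↭ (A ∨' B) ∷ Γ →
        Deriv (G ++ (A ∷ Γ ▷ Δ) ∷ H) →
        Deriv (G ++ (B ∷ Γ ▷ Δ) ∷ H) →
        Deriv (G ++ (Γ' ▷ Δ) ∷ H)
  ⊃r₁ : ∀ G Γ Δ Δ' A B → Δ' ↭ (A ⊃' B) ∷ Δ →
        Deriv (G ++ (Γ ▷ Δ) ∷ (A ∷ [] ▷ B ∷ []) ∷ []) →
        Deriv (G ++ (Γ ▷ Δ') ∷ [])
  ⊃l  : ∀ G H Γ Γ' Δ A B → Γ' ↭ (A ⊃' B) ∷ Γ →
        Deriv (G ++ (B ∷ Γ ▷ Δ) ∷ H) →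
        Deriv (G ++ (Γ' ▷ A ∷ Δ) ∷ H) →
        Deriv (G ++ (Γ' ▷ Δ) ∷ H)
  lift : ∀ G H Γ₁ Δ₁ Γ₂ Δ₂ A → A ∈ Γ₁ →
        Deriv (G ++ (Γ₁ ▷ Δ₁) ∷ (A ∷ Γ₂ ▷ Δ₂) ∷ H) →
        Deriv (G ++ (Γ₁ ▷ Δ₁) ∷ (Γ₂ ▷ Δ₂) ∷ H)
  ∀l  : ∀ G H Γ Γ' Δ x A (a : ℕ) → Γ' ↭ ∀' x A ∷ Γ →
        Deriv (G ++ ((A [ a / x ]) ∷ Γ' ▷ Δ) ∷ H) →
        Deriv (G ++ (Γ' ▷ Δ) ∷ H)
  ∀r₁ : ∀ G Γ Δ Δ' x A (a : ℕ) → Δ' ↭ ∀' x A ∷ Δ →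
        Fresh a (G ++ (Γ ▷ Δ') ∷ []) →
        Deriv (G ++ (Γ ▷ Δ) ∷ ([] ▷ (A [ a / x ]) ∷ []) ∷ []) →
        Deriv (G ++ (Γ ▷ Δ') ∷ [])
  ∃l  : ∀ G H Γ Γ' Δ x A (a : ℕ) → Γ' ↭ ∃' x A ∷ Γ →
        Fresh a (G ++ (Γ' ▷ Δ) ∷ H) →
        Deriv (G ++ ((A [ a / x ]) ∷ Γ ▷ Δ) ∷ H) →
        Deriv (G ++ (Γ' ▷ Δ) ∷ H)
  ∃r  : ∀ G H Γ Δ Δ' x A (a : ℕ) → Δ' ↭ ∃' x A ∷ Δ →
        Deriv (G ++ (Γ ▷ (A [ a / x ]) ∷ Δ') ∷ H) →
        Deriv (G ++ (Γ ▷ Δ') ∷ H)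
  ⊃r₂ : ∀ G H Γ₁ Δ₁ Δ₁' Γ₂ Δ₂ A B → Δ₁' ↭ (A ⊃' B) ∷ Δ₁ →
        Deriv (G ++ (Γ₁ ▷ Δ₁) ∷ (A ∷ [] ▷ B ∷ []) ∷ (Γ₂ ▷ Δ₂) ∷ H) →
        Deriv (G ++ (Γ₁ ▷ Δ₁) ∷ (Γ₂ ▷ (A ⊃' B) ∷ Δ₂) ∷ H) →
        Deriv (G ++ (Γ₁ ▷ Δ₁') ∷ (Γ₂ ▷ Δ₂) ∷ H)
  ∀r₂ : ∀ G H Γ₁ Δ₁ Δ₁' Γ₂ Δ₂ x A (a : ℕ) → Δ₁' ↭ ∀' x A ∷ Δ₁ →
        Fresh a (G ++ (Γ₁ ▷ Δ₁') ∷ (Γ₂ ▷ Δ₂) ∷ H) →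
        Deriv (G ++ (Γ₁ ▷ Δ₁) ∷ ([] ▷ (A [ a / x ]) ∷ []) ∷ (Γ₂ ▷ Δ₂) ∷ H) →
        Deriv (G ++ (Γ₁ ▷ Δ₁) ∷ (Γ₂ ▷ ∀' x A ∷ Δ₂) ∷ H) →
        Deriv (G ++ (Γ₁ ▷ Δ₁') ∷ (Γ₂ ▷ Δ₂) ∷ H)

height : ∀ {S} → Deriv S → ℕ
height (id₁ _ _ _ _ _ _ _ _) = 1
height (id₂ _ _ _ _ _ _ _ _ _ _ _) = 1
height (⊥l _ _ _ _ _) = 1
height (∧l _ _ _ _ _ _ _ _ d) = suc (height d)
height (∨r _ _ _ _ _ _ _ _ d) = suc (height d)
height (∧r _ _ _ _ _ _ _ _ d e) = suc (height d ⊔ height e)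
height (∨l _ _ _ _ _ _ _ _ d e) = suc (height d ⊔ height e)
height (⊃r₁ _ _ _ _ _ _ _ d) = suc (height d)
height (⊃l _ _ _ _ _ _ _ _ d e) = suc (height d ⊔ height e)
height (lift _ _ _ _ _ _ _ _ d) = suc (height d)
height (∀l _ _ _ _ _ _ _ _ _ d) = suc (height d)
height (∀r₁ _ _ _ _ _ _ _ _ _ d) = suc (height d)
height (∃l _ _ _ _ _ _ _ _ _ _ d) = suc (height d)
height (∃r _ _ _ _ _ _ _ _ _ d) = suc (height d)
height (⊃r₂ _ _ _ _ _ _ _ _ _ _ d e) = suc (height d ⊔ height e)
height (∀r₂ _ _ _ _ _ _ _ _ _ _ _ _ d e) = suc (height d ⊔ height e)

module Submission where

open import Defs
open import Data.List using (List; []; _∷_; _++_)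
open import Data.Nat using (_≤_)
open import Data.Product using (Σ)

open import Data.Nat using (ℕ; suc; s≤s; _⊔_)
open import Data.Nat.Properties using (⊔-mono-≤; ≤-refl)
open import Data.Product using (_×_; _,_; map; zip)
open import Data.List.Relation.Unary.All using (_∷_)
open import Data.List.Relation.Unary.Any using (here; there)
open import Data.List.Membership.Propositional using (_∈_)
open import Data.List.Membership.Propositional.Properties using (∈-∃++)
open import Data.List.Relation.Binary.Permutation.Propositional
  using (_↭_; prep; swap; ↭-sym; ↭-trans; ↭-refl; module PermutationReasoning)
open import Data.List.Relation.Binary.Permutation.Propositional.Properties
  using (shift; drop-∷; ∈-resp-↭; All-resp-↭)
open import Relation.Binary.PropositionalEquality using (_≢_; refl; sym)
open import Relation.Nullary using (contradiction)

-- ⊥ is never principal on the right of a sequent, so a succedent occurrence of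
-- ⊥ is passive in every rule instance and can be deleted, together with its
-- copies in the premises, without changing the shape of the derivation.  The
-- only work is when it sits in the principal component: there ⊥ differs from
-- the principal formula, so it survives in the side context of the premises.

module _ {a} {A : Set a} where

  ∈-↭-∷⁻ : {x y : A} {xs ys : List A} → x ≢ y → x ∈ xs → xs ↭ y ∷ ys → x ∈ ys
  ∈-↭-∷⁻ x≢y x∈xs p with ∈-resp-↭ p x∈xs
  ... | here x≡y = contradiction x≡y x≢y
  ... | there x∈ys = x∈ys

  ↭-∷-prep : {x y : A} {xs ys : List A} → xs ↭ y ∷ ys → x ∷ xs ↭ y ∷ x ∷ ys
  ↭-∷-prep p = ↭-trans (prep _ p) (swap _ _ ↭-refl)

  ↭-∷-distinct : {x y : A} {xs ys zs : List A} → x ≢ y →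
                 zs ↭ x ∷ xs → zs ↭ y ∷ ys →
                 Σ (List A) (λ ws → (xs ↭ y ∷ ws) × (ys ↭ x ∷ ws))
  ↭-∷-distinct {x} {y} {ys = ys} {zs} x≢y p q
    with ∈-resp-↭ p (∈-resp-↭ (↭-sym q) (here refl))
  ... | here y≡x = contradiction (sym y≡x) x≢y
  ... | there y∈xs with ∈-∃++ y∈xs
  ... | us , vs , refl = us ++ vs , shift y us vs , drop-∷ y∷ys↭y∷x∷us++vs
    where
    open PermutationReasoning
    y∷ys↭y∷x∷us++vs : y ∷ ys ↭ y ∷ x ∷ us ++ vs
    y∷ys↭y∷x∷us++vs = begin
      y ∷ ys              ↭⟨ ↭-sym q ⟩
      zs                  ↭⟨ p ⟩
      x ∷ us ++ y ∷ vs    ↭⟨ prep x (shift y us vs) ⟩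
      x ∷ y ∷ us ++ vs    ↭⟨ swap x y ↭-refl ⟩
      y ∷ x ∷ us ++ vs    ∎

data RemoveBot : LNS → LNS → Set where
  here  : {Γ Δ Δ' : List Fm} {S : LNS} → Δ' ↭ ⊥' ∷ Δ →
          RemoveBot ((Γ ▷ Δ') ∷ S) ((Γ ▷ Δ) ∷ S)
  there : {c : Comp} {S S' : LNS} → RemoveBot S S' → RemoveBot (c ∷ S) (c ∷ S')

removeBot-++⁺ˡ : {G G' : LNS} → RemoveBot G G' → (H : LNS) →
                 RemoveBot (G ++ H) (G' ++ H)
removeBot-++⁺ˡ (here p) H = here p
removeBot-++⁺ˡ (there r) H = there (removeBot-++⁺ˡ r H)

removeBot-++⁺ʳ : (G : LNS) {H H' : LNS} → RemoveBot H H' → RemoveBot (G ++ H) (G ++ H')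
removeBot-++⁺ʳ [] r = r
removeBot-++⁺ʳ (c ∷ G) r = there (removeBot-++⁺ʳ G r)

AllFms-removeBot : {P : Fm → Set} {S S' : LNS} →
                   AllFms P S → RemoveBot S S' → AllFms P S'
AllFms-removeBot ((PΓ , PΔ') ∷ PS) (here p) with All-resp-↭ p PΔ'
... | _ ∷ PΔ = (PΓ , PΔ) ∷ PS
AllFms-removeBot (Pc ∷ PS) (there r) = Pc ∷ AllFms-removeBot PS r

data Locate (G : LNS) (Γ Δ : List Fm) (H : LNS) : LNS → Set where
  left  : {G' : LNS} → RemoveBot G G' → Locate G Γ Δ H (G' ++ (Γ ▷ Δ) ∷ H)
  focus : {Δ₀ : List Fm} → Δ ↭ ⊥' ∷ Δ₀ → Locate G Γ Δ H (G ++ (Γ ▷ Δ₀) ∷ H)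
  right : {H' : LNS} → RemoveBot H H' → Locate G Γ Δ H (G ++ (Γ ▷ Δ) ∷ H')

locate : (G : LNS) (Γ Δ : List Fm) (H : LNS) {S' : LNS} →
         RemoveBot (G ++ (Γ ▷ Δ) ∷ H) S' → Locate G Γ Δ H S'
locate [] Γ Δ H (here p) = focus p
locate [] Γ Δ H (there r) = right r
locate (c ∷ G) Γ Δ H (here p) = left (here p)
locate (c ∷ G) Γ Δ H (there r) with locate G Γ Δ H r
... | left r' = left (there r')
... | focus p = focus p
... | right r' = right r'

suc-⊔-mono-≤ : {a b c d : ℕ} → a ≤ b → c ≤ d → suc (a ⊔ c) ≤ suc (b ⊔ d)
suc-⊔-mono-≤ a≤b c≤d = s≤s (⊔-mono-≤ a≤b c≤d)

BotRemovable : {S : LNS} → Deriv S → Set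
BotRemovable {S} d =
  {S' : LNS} → RemoveBot S S' → Σ (Deriv S') (λ d' → height d' ≤ height d)

id₁-botRemovable : ∀ G H Γ Δ p ts l r → BotRemovable (id₁ G H Γ Δ p ts l r)
id₁-botRemovable G H Γ Δ p ts l r ρ with locate G Γ Δ H ρ
... | left {G'} _ = id₁ G' H Γ Δ p ts l r , ≤-refl
... | focus {Δ₀} q = id₁ G H Γ Δ₀ p ts l (∈-↭-∷⁻ (λ ()) r q) , ≤-refl
... | right {H'} _ = id₁ G H' Γ Δ p ts l r , ≤-refl

id₂-botRemovable : ∀ G H F Γ₁ Δ₁ Γ₂ Δ₂ p ts l r →
  BotRemovable (id₂ G H F Γ₁ Δ₁ Γ₂ Δ₂ p ts l r)
id₂-botRemovable G H F Γ₁ Δ₁ Γ₂ Δ₂ p ts l r ρ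
  with locate G Γ₁ Δ₁ (H ++ (Γ₂ ▷ Δ₂) ∷ F) ρ
... | left {G'} _ = id₂ G' H F Γ₁ Δ₁ Γ₂ Δ₂ p ts l r , ≤-refl
... | focus {Δ₀} _ = id₂ G H F Γ₁ Δ₀ Γ₂ Δ₂ p ts l r , ≤-refl
... | right ρ' with locate H Γ₂ Δ₂ F ρ'
...   | left {H'} _ = id₂ G H' F Γ₁ Δ₁ Γ₂ Δ₂ p ts l r , ≤-refl
...   | focus {Δ₀} q = id₂ G H F Γ₁ Δ₁ Γ₂ Δ₀ p ts l (∈-↭-∷⁻ (λ ()) r q) , ≤-refl
...   | right {F'} _ = id₂ G H F' Γ₁ Δ₁ Γ₂ Δ₂ p ts l r , ≤-refl

⊥l-botRemovable : ∀ G H Γ Δ m → BotRemovable (⊥l G H Γ Δ m)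
⊥l-botRemovable G H Γ Δ m ρ with locate G Γ Δ H ρ
... | left {G'} _ = ⊥l G' H Γ Δ m , ≤-refl
... | focus {Δ₀} _ = ⊥l G H Γ Δ₀ m , ≤-refl
... | right {H'} _ = ⊥l G H' Γ Δ m , ≤-refl

∧l-botRemovable : ∀ G H Γ Γ' Δ A B π {d} →
  BotRemovable d → BotRemovable (∧l G H Γ Γ' Δ A B π d)
∧l-botRemovable G H Γ Γ' Δ A B π ih ρ with locate G Γ' Δ H ρ
... | left {G'} ρ' =
  map (∧l G' H Γ Γ' Δ A B π) s≤s (ih (removeBot-++⁺ˡ ρ' _))
... | focus {Δ₀} q =
  map (∧l G H Γ Γ' Δ₀ A B π) s≤s (ih (removeBot-++⁺ʳ G (here q)))
... | right {H'} ρ' =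
  map (∧l G H' Γ Γ' Δ A B π) s≤s (ih (removeBot-++⁺ʳ G (there ρ')))

∨r-botRemovable : ∀ G H Γ Δ Δ' A B π {d} →
  BotRemovable d → BotRemovable (∨r G H Γ Δ Δ' A B π d)
∨r-botRemovable G H Γ Δ Δ' A B π ih ρ with locate G Γ Δ' H ρ
... | left {G'} ρ' =
  map (∨r G' H Γ Δ Δ' A B π) s≤s (ih (removeBot-++⁺ˡ ρ' _))
... | focus {Δ₀} q =
  let Δ₁ , q₁ , π₀ = ↭-∷-distinct (λ ()) π q in
  map (∨r G H Γ Δ₁ Δ₀ A B π₀) s≤s
      (ih (removeBot-++⁺ʳ G (here (↭-∷-prep (↭-∷-prep q₁)))))
... | right {H'} ρ' =
  map (∨r G H' Γ Δ Δ' A B π) s≤s (ih (removeBot-++⁺ʳ G (there ρ')))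

∧r-botRemovable : ∀ G H Γ Δ Δ' A B π {d e} →
  BotRemovable d → BotRemovable e → BotRemovable (∧r G H Γ Δ Δ' A B π d e)
∧r-botRemovable G H Γ Δ Δ' A B π ih₁ ih₂ ρ with locate G Γ Δ' H ρ
... | left {G'} ρ' =
  zip (∧r G' H Γ Δ Δ' A B π) suc-⊔-mono-≤
      (ih₁ (removeBot-++⁺ˡ ρ' _))
      (ih₂ (removeBot-++⁺ˡ ρ' _))
... | focus {Δ₀} q =
  let Δ₁ , q₁ , π₀ = ↭-∷-distinct (λ ()) π q in
  zip (∧r G H Γ Δ₁ Δ₀ A B π₀) suc-⊔-mono-≤
      (ih₁ (removeBot-++⁺ʳ G (here (↭-∷-prep q₁))))
      (ih₂ (removeBot-++⁺ʳ G (here (↭-∷-prep q₁))))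
... | right {H'} ρ' =
  zip (∧r G H' Γ Δ Δ' A B π) suc-⊔-mono-≤
      (ih₁ (removeBot-++⁺ʳ G (there ρ')))
      (ih₂ (removeBot-++⁺ʳ G (there ρ')))

∨l-botRemovable : ∀ G H Γ Γ' Δ A B π {d e} →
  BotRemovable d → BotRemovable e → BotRemovable (∨l G H Γ Γ' Δ A B π d e)
∨l-botRemovable G H Γ Γ' Δ A B π ih₁ ih₂ ρ with locate G Γ' Δ H ρ
... | left {G'} ρ' =
  zip (∨l G' H Γ Γ' Δ A B π) suc-⊔-mono-≤
      (ih₁ (removeBot-++⁺ˡ ρ' _))
      (ih₂ (removeBot-++⁺ˡ ρ' _))
... | focus {Δ₀} q =
  zip (∨l G H Γ Γ' Δ₀ A B π) suc-⊔-mono-≤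
      (ih₁ (removeBot-++⁺ʳ G (here q)))
      (ih₂ (removeBot-++⁺ʳ G (here q)))
... | right {H'} ρ' =
  zip (∨l G H' Γ Γ' Δ A B π) suc-⊔-mono-≤
      (ih₁ (removeBot-++⁺ʳ G (there ρ')))
      (ih₂ (removeBot-++⁺ʳ G (there ρ')))

⊃r₁-botRemovable : ∀ G Γ Δ Δ' A B π {d} →
  BotRemovable d → BotRemovable (⊃r₁ G Γ Δ Δ' A B π d)
⊃r₁-botRemovable G Γ Δ Δ' A B π ih ρ with locate G Γ Δ' [] ρ
... | left {G'} ρ' =
  map (⊃r₁ G' Γ Δ Δ' A B π) s≤s (ih (removeBot-++⁺ˡ ρ' _))
... | focus {Δ₀} q =
  let Δ₁ , q₁ , π₀ = ↭-∷-distinct (λ ()) π q in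
  map (⊃r₁ G Γ Δ₁ Δ₀ A B π₀) s≤s (ih (removeBot-++⁺ʳ G (here q₁)))
... | right ()

⊃l-botRemovable : ∀ G H Γ Γ' Δ A B π {d e} →
  BotRemovable d → BotRemovable e → BotRemovable (⊃l G H Γ Γ' Δ A B π d e)
⊃l-botRemovable G H Γ Γ' Δ A B π ih₁ ih₂ ρ with locate G Γ' Δ H ρ
... | left {G'} ρ' =
  zip (⊃l G' H Γ Γ' Δ A B π) suc-⊔-mono-≤
      (ih₁ (removeBot-++⁺ˡ ρ' _))
      (ih₂ (removeBot-++⁺ˡ ρ' _))
... | focus {Δ₀} q =
  zip (⊃l G H Γ Γ' Δ₀ A B π) suc-⊔-mono-≤
      (ih₁ (removeBot-++⁺ʳ G (here q)))
      (ih₂ (removeBot-++⁺ʳ G (here (↭-∷-prep q))))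
... | right {H'} ρ' =
  zip (⊃l G H' Γ Γ' Δ A B π) suc-⊔-mono-≤
      (ih₁ (removeBot-++⁺ʳ G (there ρ')))
      (ih₂ (removeBot-++⁺ʳ G (there ρ')))

lift-botRemovable : ∀ G H Γ₁ Δ₁ Γ₂ Δ₂ A m {d} →
  BotRemovable d → BotRemovable (lift G H Γ₁ Δ₁ Γ₂ Δ₂ A m d)
lift-botRemovable G H Γ₁ Δ₁ Γ₂ Δ₂ A m ih ρ with locate G Γ₁ Δ₁ ((Γ₂ ▷ Δ₂) ∷ H) ρ
... | left {G'} ρ' =
  map (lift G' H Γ₁ Δ₁ Γ₂ Δ₂ A m) s≤s (ih (removeBot-++⁺ˡ ρ' _))
... | focus {Δ₀} q =
  map (lift G H Γ₁ Δ₀ Γ₂ Δ₂ A m) s≤s (ih (removeBot-++⁺ʳ G (here q)))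
... | right (here {Δ = Δ₀} q) =
  map (lift G H Γ₁ Δ₁ Γ₂ Δ₀ A m) s≤s (ih (removeBot-++⁺ʳ G (there (here q))))
... | right (there {S' = H'} ρ') =
  map (lift G H' Γ₁ Δ₁ Γ₂ Δ₂ A m) s≤s (ih (removeBot-++⁺ʳ G (there (there ρ'))))

∀l-botRemovable : ∀ G H Γ Γ' Δ x A a π {d} →
  BotRemovable d → BotRemovable (∀l G H Γ Γ' Δ x A a π d)
∀l-botRemovable G H Γ Γ' Δ x A a π ih ρ with locate G Γ' Δ H ρ
... | left {G'} ρ' =
  map (∀l G' H Γ Γ' Δ x A a π) s≤s (ih (removeBot-++⁺ˡ ρ' _))
... | focus {Δ₀} q =
  map (∀l G H Γ Γ' Δ₀ x A a π) s≤s (ih (removeBot-++⁺ʳ G (here q)))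
... | right {H'} ρ' =
  map (∀l G H' Γ Γ' Δ x A a π) s≤s (ih (removeBot-++⁺ʳ G (there ρ')))

∀r₁-botRemovable : ∀ G Γ Δ Δ' x A a π fresh {d} →
  BotRemovable d → BotRemovable (∀r₁ G Γ Δ Δ' x A a π fresh d)
∀r₁-botRemovable G Γ Δ Δ' x A a π fresh ih ρ with locate G Γ Δ' [] ρ
... | left {G'} ρ' =
  map (∀r₁ G' Γ Δ Δ' x A a π (AllFms-removeBot fresh ρ)) s≤s (ih (removeBot-++⁺ˡ ρ' _))
... | focus {Δ₀} q =
  let Δ₁ , q₁ , π₀ = ↭-∷-distinct (λ ()) π q in
  map (∀r₁ G Γ Δ₁ Δ₀ x A a π₀ (AllFms-removeBot fresh ρ)) s≤s
      (ih (removeBot-++⁺ʳ G (here q₁)))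
... | right ()

∃l-botRemovable : ∀ G H Γ Γ' Δ x A a π fresh {d} →
  BotRemovable d → BotRemovable (∃l G H Γ Γ' Δ x A a π fresh d)
∃l-botRemovable G H Γ Γ' Δ x A a π fresh ih ρ with locate G Γ' Δ H ρ
... | left {G'} ρ' =
  map (∃l G' H Γ Γ' Δ x A a π (AllFms-removeBot fresh ρ)) s≤s (ih (removeBot-++⁺ˡ ρ' _))
... | focus {Δ₀} q =
  map (∃l G H Γ Γ' Δ₀ x A a π (AllFms-removeBot fresh ρ)) s≤s
      (ih (removeBot-++⁺ʳ G (here q)))
... | right {H'} ρ' =
  map (∃l G H' Γ Γ' Δ x A a π (AllFms-removeBot fresh ρ)) s≤s
      (ih (removeBot-++⁺ʳ G (there ρ')))

∃r-botRemovable : ∀ G H Γ Δ Δ' x A a π {d} →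
  BotRemovable d → BotRemovable (∃r G H Γ Δ Δ' x A a π d)
∃r-botRemovable G H Γ Δ Δ' x A a π ih ρ with locate G Γ Δ' H ρ
... | left {G'} ρ' =
  map (∃r G' H Γ Δ Δ' x A a π) s≤s (ih (removeBot-++⁺ˡ ρ' _))
... | focus {Δ₀} q =
  let Δ₁ , q₁ , π₀ = ↭-∷-distinct (λ ()) π q in
  map (∃r G H Γ Δ₁ Δ₀ x A a π₀) s≤s (ih (removeBot-++⁺ʳ G (here (↭-∷-prep q))))
... | right {H'} ρ' =
  map (∃r G H' Γ Δ Δ' x A a π) s≤s (ih (removeBot-++⁺ʳ G (there ρ')))

⊃r₂-botRemovable : ∀ G H Γ₁ Δ₁ Δ₁' Γ₂ Δ₂ A B π {d e} →
  BotRemovable d → BotRemovable e → BotRemovable (⊃r₂ G H Γ₁ Δ₁ Δ₁' Γ₂ Δ₂ A B π d e)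
⊃r₂-botRemovable G H Γ₁ Δ₁ Δ₁' Γ₂ Δ₂ A B π ih₁ ih₂ ρ
  with locate G Γ₁ Δ₁' ((Γ₂ ▷ Δ₂) ∷ H) ρ
... | left {G'} ρ' =
  zip (⊃r₂ G' H Γ₁ Δ₁ Δ₁' Γ₂ Δ₂ A B π) suc-⊔-mono-≤
      (ih₁ (removeBot-++⁺ˡ ρ' _))
      (ih₂ (removeBot-++⁺ˡ ρ' _))
... | focus {Δ₀} q =
  let Δ₃ , q₁ , π₀ = ↭-∷-distinct (λ ()) π q in
  zip (⊃r₂ G H Γ₁ Δ₃ Δ₀ Γ₂ Δ₂ A B π₀) suc-⊔-mono-≤
      (ih₁ (removeBot-++⁺ʳ G (here q₁)))
      (ih₂ (removeBot-++⁺ʳ G (here q₁)))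
... | right (here {Δ = Δ₀} q) =
  zip (⊃r₂ G H Γ₁ Δ₁ Δ₁' Γ₂ Δ₀ A B π) suc-⊔-mono-≤
      (ih₁ (removeBot-++⁺ʳ G (there (there (here q)))))
      (ih₂ (removeBot-++⁺ʳ G (there (here (↭-∷-prep q)))))
... | right (there {S' = H'} ρ') =
  zip (⊃r₂ G H' Γ₁ Δ₁ Δ₁' Γ₂ Δ₂ A B π) suc-⊔-mono-≤
      (ih₁ (removeBot-++⁺ʳ G (there (there (there ρ')))))
      (ih₂ (removeBot-++⁺ʳ G (there (there ρ'))))

∀r₂-botRemovable : ∀ G H Γ₁ Δ₁ Δ₁' Γ₂ Δ₂ x A a π fresh {d e} →
  BotRemovable d → BotRemovable e →
  BotRemovable (∀r₂ G H Γ₁ Δ₁ Δ₁' Γ₂ Δ₂ x A a π fresh d e)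
∀r₂-botRemovable G H Γ₁ Δ₁ Δ₁' Γ₂ Δ₂ x A a π fresh ih₁ ih₂ ρ
  with locate G Γ₁ Δ₁' ((Γ₂ ▷ Δ₂) ∷ H) ρ
... | left {G'} ρ' =
  zip (∀r₂ G' H Γ₁ Δ₁ Δ₁' Γ₂ Δ₂ x A a π (AllFms-removeBot fresh ρ)) suc-⊔-mono-≤
      (ih₁ (removeBot-++⁺ˡ ρ' _))
      (ih₂ (removeBot-++⁺ˡ ρ' _))
... | focus {Δ₀} q =
  let Δ₃ , q₁ , π₀ = ↭-∷-distinct (λ ()) π q in
  zip (∀r₂ G H Γ₁ Δ₃ Δ₀ Γ₂ Δ₂ x A a π₀ (AllFms-removeBot fresh ρ)) suc-⊔-mono-≤
      (ih₁ (removeBot-++⁺ʳ G (here q₁)))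
      (ih₂ (removeBot-++⁺ʳ G (here q₁)))
... | right (here {Δ = Δ₀} q) =
  zip (∀r₂ G H Γ₁ Δ₁ Δ₁' Γ₂ Δ₀ x A a π (AllFms-removeBot fresh ρ)) suc-⊔-mono-≤
      (ih₁ (removeBot-++⁺ʳ G (there (there (here q)))))
      (ih₂ (removeBot-++⁺ʳ G (there (here (↭-∷-prep q)))))
... | right (there {S' = H'} ρ') =
  zip (∀r₂ G H' Γ₁ Δ₁ Δ₁' Γ₂ Δ₂ x A a π (AllFms-removeBot fresh ρ)) suc-⊔-mono-≤
      (ih₁ (removeBot-++⁺ʳ G (there (there (there ρ')))))
      (ih₂ (removeBot-++⁺ʳ G (there (there ρ'))))

botRemovable : {S : LNS} (d : Deriv S) → BotRemovable d
botRemovable (id₁ G H Γ Δ p ts l r) =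
  id₁-botRemovable G H Γ Δ p ts l r
botRemovable (id₂ G H F Γ₁ Δ₁ Γ₂ Δ₂ p ts l r) =
  id₂-botRemovable G H F Γ₁ Δ₁ Γ₂ Δ₂ p ts l r
botRemovable (⊥l G H Γ Δ m) =
  ⊥l-botRemovable G H Γ Δ m
botRemovable (∧l G H Γ Γ' Δ A B π d) =
  ∧l-botRemovable G H Γ Γ' Δ A B π (botRemovable d)
botRemovable (∨r G H Γ Δ Δ' A B π d) =
  ∨r-botRemovable G H Γ Δ Δ' A B π (botRemovable d)
botRemovable (∧r G H Γ Δ Δ' A B π d e) =
  ∧r-botRemovable G H Γ Δ Δ' A B π (botRemovable d) (botRemovable e)
botRemovable (∨l G H Γ Γ' Δ A B π d e) =
  ∨l-botRemovable G H Γ Γ' Δ A B π (botRemovable d) (botRemovable e)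
botRemovable (⊃r₁ G Γ Δ Δ' A B π d) =
  ⊃r₁-botRemovable G Γ Δ Δ' A B π (botRemovable d)
botRemovable (⊃l G H Γ Γ' Δ A B π d e) =
  ⊃l-botRemovable G H Γ Γ' Δ A B π (botRemovable d) (botRemovable e)
botRemovable (lift G H Γ₁ Δ₁ Γ₂ Δ₂ A m d) =
  lift-botRemovable G H Γ₁ Δ₁ Γ₂ Δ₂ A m (botRemovable d)
botRemovable (∀l G H Γ Γ' Δ x A a π d) =
  ∀l-botRemovable G H Γ Γ' Δ x A a π (botRemovable d)
botRemovable (∀r₁ G Γ Δ Δ' x A a π fresh d) =
  ∀r₁-botRemovable G Γ Δ Δ' x A a π fresh (botRemovable d)
botRemovable (∃l G H Γ Γ' Δ x A a π fresh d) =
  ∃l-botRemovable G H Γ Γ' Δ x A a π fresh (botRemovable d)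
botRemovable (∃r G H Γ Δ Δ' x A a π d) =
  ∃r-botRemovable G H Γ Δ Δ' x A a π (botRemovable d)
botRemovable (⊃r₂ G H Γ₁ Δ₁ Δ₁' Γ₂ Δ₂ A B π d e) =
  ⊃r₂-botRemovable G H Γ₁ Δ₁ Δ₁' Γ₂ Δ₂ A B π (botRemovable d) (botRemovable e)
botRemovable (∀r₂ G H Γ₁ Δ₁ Δ₁' Γ₂ Δ₂ x A a π fresh d e) =
  ∀r₂-botRemovable G H Γ₁ Δ₁ Δ₁' Γ₂ Δ₂ x A a π fresh (botRemovable d) (botRemovable e)

lemma3 : (G H : LNS) (Γ Δ : List Fm) →
    ClosedS (G ++ (Γ ▷ (⊥' ∷ Δ)) ∷ H) →
    (d : Deriv (G ++ (Γ ▷ (⊥' ∷ Δ)) ∷ H)) →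
    Σ (Deriv (G ++ (Γ ▷ Δ) ∷ H)) (λ d' → height d' ≤ height d)
lemma3 G H Γ Δ _ d = botRemovable d (removeBot-++⁺ʳ G (here ↭-refl))
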